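{- Let $\mathfrak{B}$ be the category of Bochvar algebras with homomorphisms, and $\mathfrak{S}$ the category of Bochvar systems. Define $\Gamma$ by $\Gamma(\mathbf{A}):=\mathbb{B}_{\mathbf{A}}$ on objects and, for a homomorphism $f:\mathbf{A}_1\to\mathbf{A}_2$ of Bochvar algebras, $\Gamma(f):=$ the restriction of $f$ to the bottom fibre $A_{1,i_0}$ of $\mathbf{A}_1$. Then $\Gamma$ is a functor from $\mathfrak{B}$ to $\mathfrak{S}$.
   Context: Bochvar algebras: $\mathbf{WK}^e$ is the algebra on $\{0,\tfrac12,1\}$ of type $\langle\wedge,\vee,\neg,J_2,0,1\rangle$ with $\neg0=1,\neg\tfrac12=\tfrac12,\neg1=0$, $\vee,\wedge$ Boolean on $\{0,1\}$ and outputting $\tfrac12$ whenever an argument is $\tfrac12$, $J_21=1$, $J_2\tfrac12=J_20=0$; Bochvar algebras form $ISP(\mathbf{WK}^e)$. The involutive bisemilattice reduct of a Bochvar algebra $\mathbf{A}$ is a Płonka sum of a semilattice direct system of Boolean algebras $\{\mathbf{A}_i\}_{i\in I}$ over a lower-bounded join-semilattice $\langle I,\vee,i_0\rangle$; $\mathbf{A}_{i_0}$ is the bottom fibre. A Bochvar system is a pair $\langle\mathbf{B},\mathbf{I}\rangle$ with $\mathbf{B}$ a Boolean algebra and $I\subseteq B$ containing $1$ and closed under $\wedge$; a morphism $\langle\mathbf{B}_1,\mathbf{I}_1\rangle\to\langle\mathbf{B}_2,\mathbf{I}_2\rangle$ in $\mathfrak{S}$ is a Boolean homomorphism $g:\mathbf{B}_1\to\mathbf{B}_2$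 with $g(i)\in I_2$ for all $i\in I_1$. $\mathbb{B}_{\mathbf{A}}:=\langle\mathbf{A}_{i_0},\mathbf{K}\rangle$ with $K=\{J_2(1^{\mathbf{A}_i}): i\in I\}$, where $1^{\mathbf{A}_i}$ is the top of fibre $\mathbf{A}_i$. -}

module Defs where

open import Level using (0ℓ)
open import Data.Product using (Σ; _×_; _,_; proj₁; proj₂)
open import Relation.Binary.PropositionalEquality using (_≡_)
open import Algebra.Lattice.Structures using (IsBooleanAlgebra)

data W3 : Set where
  w0 wh w1 : W3

¬w : W3 → W3
¬w w0 = w1
¬w wh = wh
¬w w1 = w0

_∧w_ : W3 → W3 → W3
wh ∧w _  = wh
w0 ∧w wh = wh
w1 ∧w wh = wh
w0 ∧w w0 = w0
w0 ∧w w1 = w0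
w1 ∧w w0 = w0
w1 ∧w w1 = w1

_∨w_ : W3 → W3 → W3
wh ∨w _  = wh
w0 ∨w wh = wh
w1 ∨w wh = wh
w0 ∨w w0 = w0
w0 ∨w w1 = w1
w1 ∨w w0 = w1
w1 ∨w w1 = w1

J₂w : W3 → W3
J₂w w1 = w1
J₂w wh = w0
J₂w w0 = w0

record Alg : Set₁ where
  field
    Carrier : Set
    _∧_ _∨_ : Carrier → Carrier → Carrier
    ¬_ J₂   : Carrier → Carrier
    𝟎 𝟏     : Carrier

-- Bochvar algebras = ISP(WK^e): algebras A with an injective homomorphism
-- into a power (WK^e)^X of WK^e (products of copies of WK^e are powers).
record BochvarAlgebra : Set₁ where
  field
    alg : Alg
  open Alg alg public
  field
    Idx   : Set
    emb   : Carrier → Idx → W3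
    emb-∧ : ∀ a b x → emb (a ∧ b) x ≡ (emb a x ∧w emb b x)
    emb-∨ : ∀ a b x → emb (a ∨ b) x ≡ (emb a x ∨w emb b x)
    emb-¬ : ∀ a x → emb (¬ a) x ≡ ¬w (emb a x)
    emb-J : ∀ a x → emb (J₂ a) x ≡ J₂w (emb a x)
    emb-0 : ∀ x → emb 𝟎 x ≡ w0
    emb-1 : ∀ x → emb 𝟏 x ≡ w1
    emb-inj : ∀ a b → (∀ x → emb a x ≡ emb b x) → a ≡ b

record IsHom (A B : BochvarAlgebra) (f : BochvarAlgebra.Carrier A → BochvarAlgebra.Carrier B) : Set where
  private
    module A = BochvarAlgebra A
    module B = BochvarAlgebra B
  field
    f-∧ : ∀ a b → f (a A.∧ b) ≡ (f a B.∧ f b)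
    f-∨ : ∀ a b → f (a A.∨ b) ≡ (f a B.∨ f b)
    f-¬ : ∀ a → f (A.¬ a) ≡ B.¬ (f a)
    f-J : ∀ a → f (A.J₂ a) ≡ B.J₂ (f a)
    f-0 : f A.𝟎 ≡ B.𝟎
    f-1 : f A.𝟏 ≡ B.𝟏

Hom : BochvarAlgebra → BochvarAlgebra → Set
Hom A B = Σ (BochvarAlgebra.Carrier A → BochvarAlgebra.Carrier B) (IsHom A B)

-- Płonka decomposition of the involutive bisemilattice reduct.
-- Two elements lie in the same fibre iff the partition function
-- p(x,y) = x ∧ (x ∨ y) satisfies p(a,b) = a and p(b,a) = b.

module _ (A : BochvarAlgebra) where
  open BochvarAlgebra A

  SameFibre : Carrier → Carrier → Set
  SameFibre a b = ((a ∧ (a ∨ b)) ≡ a) × ((b ∧ (b ∨ a)) ≡ b)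

  -- the bottom fibre A_{i₀} is the fibre containing the constants (that of 0)
  BotFib : Carrier → Set
  BotFib a = SameFibre a 𝟎

  -- t is the top 1^{A_i} of its fibre A_i (order of the Boolean fibre: b ≤ t iff b ∨ t = t)
  IsFibreTop : Carrier → Set
  IsFibreTop t = ∀ b → SameFibre b t → (b ∨ t) ≡ t

  K : Carrier → Set
  K k = Σ Carrier (λ t → IsFibreTop t × (k ≡ J₂ t))

  record BotClosed : Set where
    field
      ∧-cl : ∀ a b → BotFib a → BotFib b → BotFib (a ∧ b)
      ∨-cl : ∀ a b → BotFib a → BotFib b → BotFib (a ∨ b)
      ¬-cl : ∀ a → BotFib a → BotFib (¬ a)
      0-cl : BotFib 𝟎
      1-cl : BotFib 𝟏

record RawSys : Set₁ where
  field
    Carrier : Set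
    _≈_     : Carrier → Carrier → Set
    _∧_ _∨_ : Carrier → Carrier → Carrier
    ¬_      : Carrier → Carrier
    𝟎 𝟏     : Carrier
    I       : Carrier → Set

record IsBochvarSystem (S : RawSys) : Set where
  open RawSys S
  field
    isBooleanAlgebra : IsBooleanAlgebra _≈_ _∨_ _∧_ ¬_ 𝟏 𝟎
    I-resp : ∀ x y → x ≈ y → I x → I y
    I-𝟏    : I 𝟏
    I-∧    : ∀ x y → I x → I y → I (x ∧ y)

record IsSysMorphism (S T : RawSys) (g : RawSys.Carrier S → RawSys.Carrier T) : Set where
  private
    module S = RawSys S
    module T = RawSys T
  field
    g-cong : ∀ x y → x S.≈ y → g x T.≈ g y
    g-∧ : ∀ x y → g (x S.∧ y) T.≈ (g x T.∧ g y)
    g-∨ : ∀ x y → g (x S.∨ y) T.≈ (g x T.∨ g y)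
    g-¬ : ∀ x → g (S.¬ x) T.≈ (T.¬ (g x))
    g-0 : g S.𝟎 T.≈ T.𝟎
    g-1 : g S.𝟏 T.≈ T.𝟏
    g-I : ∀ x → S.I x → T.I (g x)

-- Γ(A) = 𝔹_A = ⟨A_{i₀}, K⟩ (the restricted operations need closure of A_{i₀})
ΓObj : (A : BochvarAlgebra) → BotClosed A → RawSys
ΓObj A c = record
  { Carrier = Σ Carrier (BotFib A)
  ; _≈_ = λ x y → proj₁ x ≡ proj₁ y
  ; _∧_ = λ x y → (proj₁ x ∧ proj₁ y) , ∧-cl _ _ (proj₂ x) (proj₂ y)
  ; _∨_ = λ x y → (proj₁ x ∨ proj₁ y) , ∨-cl _ _ (proj₂ x) (proj₂ y)
  ; ¬_ = λ x → (¬ proj₁ x) , ¬-cl _ (proj₂ x)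
  ; 𝟎 = 𝟎 , 0-cl
  ; 𝟏 = 𝟏 , 1-cl
  ; I = λ x → K A (proj₁ x)
  }
  where
  open BochvarAlgebra A
  open BotClosed c

ΓMap : (A₁ A₂ : BochvarAlgebra) (f : Hom A₁ A₂)
     → (∀ a → BotFib A₁ a → BotFib A₂ (proj₁ f a))
     → Σ (BochvarAlgebra.Carrier A₁) (BotFib A₁) → Σ (BochvarAlgebra.Carrier A₂) (BotFib A₂)
ΓMap A₁ A₂ f p x = proj₁ f (proj₁ x) , p (proj₁ x) (proj₂ x)

idHom : (A : BochvarAlgebra) → Hom A A
idHom A = (λ a → a) , record
  { f-∧ = λ _ _ → refl' ; f-∨ = λ _ _ → refl' ; f-¬ = λ _ → refl'
  ; f-J = λ _ → refl' ; f-0 = refl' ; f-1 = refl' }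
  where
  open import Relation.Binary.PropositionalEquality using () renaming (refl to refl')

_∘H_ : {A B C : BochvarAlgebra} → Hom B C → Hom A B → Hom A C
_∘H_ {A} {B} {C} (g , hg) (f , hf) = (λ a → g (f a)) , record
  { f-∧ = λ a b → trans (cong g (IsHom.f-∧ hf a b)) (IsHom.f-∧ hg _ _)
  ; f-∨ = λ a b → trans (cong g (IsHom.f-∨ hf a b)) (IsHom.f-∨ hg _ _)
  ; f-¬ = λ a → trans (cong g (IsHom.f-¬ hf a)) (IsHom.f-¬ hg _)
  ; f-J = λ a → trans (cong g (IsHom.f-J hf a)) (IsHom.f-J hg _)
  ; f-0 = trans (cong g (IsHom.f-0 hf)) (IsHom.f-0 hg)
  ; f-1 = trans (cong g (IsHom.f-1 hf)) (IsHom.f-1 hg)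
  }
  where
  open import Relation.Binary.PropositionalEquality using (trans; cong)

-- "Γ is a functor from 𝔅 to 𝔖": Γ is well defined on objects (𝔹_A is a
-- Bochvar system) and on morphisms (Γ(f) is a morphism of 𝔖), and it
-- preserves identities and composition.
record GammaIsFunctor : Set₁ where
  field
    closed   : (A : BochvarAlgebra) → BotClosed A
    isSystem : (A : BochvarAlgebra) → IsBochvarSystem (ΓObj A (closed A))
    botPres  : (A₁ A₂ : BochvarAlgebra) (f : Hom A₁ A₂)
             → ∀ a → BotFib A₁ a → BotFib A₂ (proj₁ f a)
    isMorph  : (A₁ A₂ : BochvarAlgebra) (f : Hom A₁ A₂)
             → IsSysMorphism (ΓObj A₁ (closed A₁)) (ΓObj A₂ (closed A₂)) (ΓMap A₁ A₂ f (botPres A₁ A₂ f))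
    pres-id  : (A : BochvarAlgebra) → ∀ x
             → RawSys._≈_ (ΓObj A (closed A)) (ΓMap A A (idHom A) (botPres A A (idHom A)) x) x
    pres-∘   : (A₁ A₂ A₃ : BochvarAlgebra) (g : Hom A₂ A₃) (f : Hom A₁ A₂) → ∀ x
             → RawSys._≈_ (ΓObj A₃ (closed A₃))
                 (ΓMap A₁ A₃ (_∘H_ {A₁} {A₂} {A₃} g f) (botPres A₁ A₃ (_∘H_ {A₁} {A₂} {A₃} g f)) x)
                 (ΓMap A₂ A₃ g (botPres A₂ A₃ g) (ΓMap A₁ A₂ f (botPres A₁ A₂ f) x))

-- A Bochvar algebra A embeds into a power of WKᵉ, so A satisfies every identity of WKᵉ, and
-- its bottom fibre, whose elements have only Boolean coordinates, satisfies every identity of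
-- the two-element Boolean algebra; this makes 𝔹_A a Boolean algebra. The fibre tops are
-- exactly the solutions of ¬ t ∨ t = t, so they are closed under ∧ and preserved by
-- homomorphisms, as are the equationally defined bottom fibres. Γ then acts on morphisms by
-- restriction, which is strictly functorial.
module Submission where

open import Defs
open import Data.Nat using (ℕ; zero; suc)
open import Data.Fin using (Fin; zero; suc)
open import Data.Unit using (⊤; tt)
open import Data.Product using (Σ; _,_; proj₁; proj₂)
open import Data.Vec using (Vec; []; _∷_; lookup; map)
open import Data.Vec.Properties using (lookup-map)
open import Data.Vec.Relation.Unary.All as All using (All; []; _∷_)
open import Data.Vec.Relation.Unary.All.Properties using (map⁺)
open import Relation.Binary.Definitions using (DecidableEquality)
open import Relation.Binary.PropositionalEquality
open import Relation.Nullary.Decidable using (Dec; yes; no; True; toWitness; map′; _×-dec_; _→-dec_)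
open import Relation.Unary using (Decidable)
open import Algebra.Lattice.Structures using (IsBooleanAlgebra)

WKᵉ : BochvarAlgebra
WKᵉ = record
  { alg     = record { Carrier = W3 ; _∧_ = _∧w_ ; _∨_ = _∨w_ ; ¬_ = ¬w ; J₂ = J₂w ; 𝟎 = w0 ; 𝟏 = w1 }
  ; Idx     = ⊤
  ; emb     = λ u _ → u
  ; emb-∧   = λ _ _ _ → refl
  ; emb-∨   = λ _ _ _ → refl
  ; emb-¬   = λ _ _ → refl
  ; emb-J   = λ _ _ → refl
  ; emb-0   = λ _ → refl
  ; emb-1   = λ _ → refl
  ; emb-inj = λ _ _ e → e tt
  }

_≟_ : DecidableEquality W3
w0 ≟ w0 = yes refl
w0 ≟ wh = no λ ()
w0 ≟ w1 = no λ ()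
wh ≟ w0 = no λ ()
wh ≟ wh = yes refl
wh ≟ w1 = no λ ()
w1 ≟ w0 = no λ ()
w1 ≟ wh = no λ ()
w1 ≟ w1 = yes refl

∀-W3? : {Q : W3 → Set} → (∀ u → Dec (Q u)) → Dec (∀ u → Q u)
∀-W3? Q? = map′ (λ { (q₀ , qₕ , q₁) → λ { w0 → q₀ ; wh → qₕ ; w1 → q₁ } })
                (λ q → q w0 , q wh , q w1)
                (Q? w0 ×-dec Q? wh ×-dec Q? w1)

∀-Vec? : ∀ n {P : Vec W3 n → Set} → (∀ σ → Dec (P σ)) → Dec (∀ σ → P σ)
∀-Vec? zero    P? = map′ (λ p → λ { [] → p }) (λ p → p []) (P? [])
∀-Vec? (suc n) P? = map′ (λ p → λ { (u ∷ σ) → p u σ }) (λ p u σ → p (u ∷ σ))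
                         (∀-W3? λ u → ∀-Vec? n λ σ → P? (u ∷ σ))

data Boolean : W3 → Set where
  false : Boolean w0
  true  : Boolean w1

boolean? : Decidable Boolean
boolean? w0 = yes false
boolean? wh = no λ ()
boolean? w1 = yes true

boolean-from-bottom : ∀ u → w0 ∧w (w0 ∨w u) ≡ w0 → Boolean u
boolean-from-bottom w0 _ = false
boolean-from-bottom w1 _ = true

data Term (n : ℕ) : Set where
  var       : Fin n → Term n
  _∧ᵗ_ _∨ᵗ_ : Term n → Term n → Term n
  ¬ᵗ_ J₂ᵗ   : Term n → Term n
  𝟎ᵗ 𝟏ᵗ     : Term n

infixr 6 _∧ᵗ_
infixr 5 _∨ᵗ_
infix  7 ¬ᵗ_

x : ∀ {n} → Term (suc n)
x = var zero

y : ∀ {n} → Term (suc (suc n))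
y = var (suc zero)

z : ∀ {n} → Term (suc (suc (suc n)))
z = var (suc (suc zero))

module _ (A : BochvarAlgebra) where
  open BochvarAlgebra A

  eval : ∀ {n} → Term n → Vec Carrier n → Carrier
  eval (var i)  ρ = lookup ρ i
  eval (s ∧ᵗ t) ρ = eval s ρ ∧ eval t ρ
  eval (s ∨ᵗ t) ρ = eval s ρ ∨ eval t ρ
  eval (¬ᵗ s)   ρ = ¬ eval s ρ
  eval (J₂ᵗ s)  ρ = J₂ (eval s ρ)
  eval 𝟎ᵗ       ρ = 𝟎
  eval 𝟏ᵗ       ρ = 𝟏

  syntax eval A t ρ = A ⟦ t ⟧ ρ

module _ {A B : BochvarAlgebra} {f : BochvarAlgebra.Carrier A → BochvarAlgebra.Carrier B}
         (f-hom : IsHom A B f) where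
  open IsHom f-hom
  private
    module B = BochvarAlgebra B

  ⟦⟧-hom : ∀ {n} (t : Term n) ρ → f (A ⟦ t ⟧ ρ) ≡ B ⟦ t ⟧ map f ρ
  ⟦⟧-hom (var i)  ρ = sym (lookup-map i f ρ)
  ⟦⟧-hom (s ∧ᵗ t) ρ = trans (f-∧ _ _) (cong₂ B._∧_ (⟦⟧-hom s ρ) (⟦⟧-hom t ρ))
  ⟦⟧-hom (s ∨ᵗ t) ρ = trans (f-∨ _ _) (cong₂ B._∨_ (⟦⟧-hom s ρ) (⟦⟧-hom t ρ))
  ⟦⟧-hom (¬ᵗ s)   ρ = trans (f-¬ _) (cong B.¬_ (⟦⟧-hom s ρ))
  ⟦⟧-hom (J₂ᵗ s)  ρ = trans (f-J _) (cong B.J₂ (⟦⟧-hom s ρ))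
  ⟦⟧-hom 𝟎ᵗ       ρ = f-0
  ⟦⟧-hom 𝟏ᵗ       ρ = f-1

  hom-preserves-≡ : ∀ {n} (s t : Term n) ρ → A ⟦ s ⟧ ρ ≡ A ⟦ t ⟧ ρ → B ⟦ s ⟧ map f ρ ≡ B ⟦ t ⟧ map f ρ
  hom-preserves-≡ s t ρ e = trans (sym (⟦⟧-hom s ρ)) (trans (cong f e) (⟦⟧-hom t ρ))

coordinate-isHom : (A : BochvarAlgebra) (i : BochvarAlgebra.Idx A) → IsHom A WKᵉ (λ a → BochvarAlgebra.emb A a i)
coordinate-isHom A i = record
  { f-∧ = λ a b → emb-∧ a b i ; f-∨ = λ a b → emb-∨ a b i ; f-¬ = λ a → emb-¬ a i
  ; f-J = λ a → emb-J a i ; f-0 = emb-0 i ; f-1 = emb-1 i }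
  where open BochvarAlgebra A

ValidOn : (W3 → Set) → ∀ {n} → Term n → Term n → Set
ValidOn S s t = ∀ σ → All S σ → WKᵉ ⟦ s ⟧ σ ≡ WKᵉ ⟦ t ⟧ σ

validOn? : {S : W3 → Set} → Decidable S → ∀ {n} (s t : Term n) → Dec (ValidOn S s t)
validOn? S? {n} s t = ∀-Vec? n λ σ → All.all? S? σ →-dec (WKᵉ ⟦ s ⟧ σ) ≟ (WKᵉ ⟦ t ⟧ σ)

module _ (A : BochvarAlgebra) where
  open BochvarAlgebra A

  transfer : ∀ {S n} (s t : Term n) → ValidOn S s t
           → ∀ ρ → (∀ i → All S (map (λ a → emb a i) ρ)) → A ⟦ s ⟧ ρ ≡ A ⟦ t ⟧ ρ
  transfer s t valid ρ coordinates-in-S = emb-inj _ _ λ i →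
    trans (⟦⟧-hom (coordinate-isHom A i) s ρ)
      (trans (valid _ (coordinates-in-S i)) (sym (⟦⟧-hom (coordinate-isHom A i) t ρ)))

  -- The implicit argument is tt and inferred: validOn? normalises to yes by enumerating valuations.
  identity : ∀ {n} (s t : Term n) {_ : True (validOn? (λ _ → yes tt) s t)}
           → ∀ ρ → A ⟦ s ⟧ ρ ≡ A ⟦ t ⟧ ρ
  identity s t {valid} ρ = transfer s t (toWitness valid) ρ λ _ → All.universal (λ _ → tt) _

  Bot : Set
  Bot = Σ Carrier (BotFib A)

  bottom-coordinates-boolean : ∀ {a} → BotFib A a → ∀ i → Boolean (emb a i)
  bottom-coordinates-boolean (_ , 𝟎-absorbs) i =
    boolean-from-bottom _ (hom-preserves-≡ (coordinate-isHom A i) (𝟎ᵗ ∧ᵗ (𝟎ᵗ ∨ᵗ x)) 𝟎ᵗ (_ ∷ []) 𝟎-absorbs)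

  booleanIdentity : ∀ {n} (s t : Term n) {_ : True (validOn? boolean? s t)}
                  → (bs : Vec Bot n) → A ⟦ s ⟧ map proj₁ bs ≡ A ⟦ t ⟧ map proj₁ bs
  booleanIdentity s t {valid} bs = transfer s t (toWitness valid) (map proj₁ bs) λ i →
    map⁺ (map⁺ (All.universal (λ b → bottom-coordinates-boolean (proj₂ b) i) bs))

  bottom-closed : ∀ {n} (t : Term n)
                  {_ : True (validOn? boolean? (t ∧ᵗ (t ∨ᵗ 𝟎ᵗ)) t)} {_ : True (validOn? boolean? (𝟎ᵗ ∧ᵗ (𝟎ᵗ ∨ᵗ t)) 𝟎ᵗ)}
                → (bs : Vec Bot n) → BotFib A (A ⟦ t ⟧ map proj₁ bs)
  bottom-closed t {v₁} {v₂} bs =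
    booleanIdentity (t ∧ᵗ (t ∨ᵗ 𝟎ᵗ)) t {v₁} bs , booleanIdentity (𝟎ᵗ ∧ᵗ (𝟎ᵗ ∨ᵗ t)) 𝟎ᵗ {v₂} bs

  bottomFibre-closed : BotClosed A
  bottomFibre-closed = record
    { ∧-cl = λ a b pa pb → bottom-closed (x ∧ᵗ y) ((a , pa) ∷ (b , pb) ∷ [])
    ; ∨-cl = λ a b pa pb → bottom-closed (x ∨ᵗ y) ((a , pa) ∷ (b , pb) ∷ [])
    ; ¬-cl = λ a pa → bottom-closed (¬ᵗ x) ((a , pa) ∷ [])
    ; 0-cl = bottom-closed 𝟎ᵗ []
    ; 1-cl = bottom-closed 𝟏ᵗ []
    }

  fibreTop⇒¬∨-fixed : ∀ {t} → IsFibreTop A t → (¬ t) ∨ t ≡ t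
  fibreTop⇒¬∨-fixed {t} top =
    top (¬ t) (identity (¬ᵗ x ∧ᵗ (¬ᵗ x ∨ᵗ x)) (¬ᵗ x) (t ∷ []) , identity (x ∧ᵗ (x ∨ᵗ ¬ᵗ x)) x (t ∷ []))

  -- ¬ s ∨ s lies in {½, 1} at every coordinate, so identities about such terms need no
  -- hypothesis on s; rewriting with ¬ t ∨ t ≡ t transports them to t itself.
  ¬∨-fixed⇒fibreTop : ∀ {t} → (¬ t) ∨ t ≡ t → IsFibreTop A t
  ¬∨-fixed⇒fibreTop {t} fixed b (_ , t-absorbs) = begin
    b ∨ t                ≡⟨ cong (b ∨_) (sym t-absorbs) ⟩
    b ∨ (t ∧ (t ∨ b))    ≡⟨ subst (λ u → b ∨ (u ∧ (u ∨ b)) ≡ u ∧ (u ∨ b)) fixed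
                                  (identity (y ∨ᵗ (x′ ∧ᵗ (x′ ∨ᵗ y))) (x′ ∧ᵗ (x′ ∨ᵗ y)) (t ∷ b ∷ [])) ⟩
    t ∧ (t ∨ b)          ≡⟨ t-absorbs ⟩
    t                    ∎
    where
    open ≡-Reasoning
    x′ : Term 2
    x′ = ¬ᵗ x ∨ᵗ x

  fibreTop-∧ : ∀ {t u} → IsFibreTop A t → IsFibreTop A u → IsFibreTop A (t ∧ u)
  fibreTop-∧ {t} {u} t-top u-top = ¬∨-fixed⇒fibreTop
    (subst₂ (λ t u → (¬ (t ∧ u)) ∨ (t ∧ u) ≡ t ∧ u) (fibreTop⇒¬∨-fixed t-top) (fibreTop⇒¬∨-fixed u-top)
            (identity (¬ᵗ (x′ ∧ᵗ y′) ∨ᵗ (x′ ∧ᵗ y′)) (x′ ∧ᵗ y′) (t ∷ u ∷ [])))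
    where
    x′ y′ : Term 2
    x′ = ¬ᵗ x ∨ᵗ x
    y′ = ¬ᵗ y ∨ᵗ y

  𝟏∈K : K A 𝟏
  𝟏∈K = 𝟏 , ¬∨-fixed⇒fibreTop (identity (¬ᵗ 𝟏ᵗ ∨ᵗ 𝟏ᵗ) 𝟏ᵗ []) , identity 𝟏ᵗ (J₂ᵗ 𝟏ᵗ) []

  K-∧ : ∀ {k l} → K A k → K A l → K A (k ∧ l)
  K-∧ (t , t-top , refl) (u , u-top , refl) =
    t ∧ u , fibreTop-∧ t-top u-top , identity (J₂ᵗ x ∧ᵗ J₂ᵗ y) (J₂ᵗ (x ∧ᵗ y)) (t ∷ u ∷ [])

  private
    module 𝔹 = RawSys (ΓObj A bottomFibre-closed)

  bottomFibre-isBooleanAlgebra : IsBooleanAlgebra 𝔹._≈_ 𝔹._∨_ 𝔹._∧_ 𝔹.¬_ 𝔹.𝟏 𝔹.𝟎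
  bottomFibre-isBooleanAlgebra = record
    { isDistributiveLattice = record
      { isLattice = record
        { isEquivalence = record { refl = refl ; sym = sym ; trans = trans }
        ; ∨-comm        = λ a b → law (x ∨ᵗ y) (y ∨ᵗ x) (a ∷ b ∷ [])
        ; ∨-assoc       = λ a b c → law ((x ∨ᵗ y) ∨ᵗ z) (x ∨ᵗ (y ∨ᵗ z)) (a ∷ b ∷ c ∷ [])
        ; ∨-cong        = cong₂ _∨_
        ; ∧-comm        = λ a b → law (x ∧ᵗ y) (y ∧ᵗ x) (a ∷ b ∷ [])
        ; ∧-assoc       = λ a b c → law ((x ∧ᵗ y) ∧ᵗ z) (x ∧ᵗ (y ∧ᵗ z)) (a ∷ b ∷ c ∷ [])
        ; ∧-cong        = cong₂ _∧_
        ; absorptive    = (λ a b → law (x ∨ᵗ (x ∧ᵗ y)) x (a ∷ b ∷ []))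
                        , (λ a b → law (x ∧ᵗ (x ∨ᵗ y)) x (a ∷ b ∷ []))
        }
      ; ∨-distrib-∧ = (λ a b c → law (x ∨ᵗ (y ∧ᵗ z)) ((x ∨ᵗ y) ∧ᵗ (x ∨ᵗ z)) (a ∷ b ∷ c ∷ []))
                    , (λ a b c → law ((y ∧ᵗ z) ∨ᵗ x) ((y ∨ᵗ x) ∧ᵗ (z ∨ᵗ x)) (a ∷ b ∷ c ∷ []))
      ; ∧-distrib-∨ = (λ a b c → law (x ∧ᵗ (y ∨ᵗ z)) ((x ∧ᵗ y) ∨ᵗ (x ∧ᵗ z)) (a ∷ b ∷ c ∷ []))
                    , (λ a b c → law ((y ∨ᵗ z) ∧ᵗ x) ((y ∧ᵗ x) ∨ᵗ (z ∧ᵗ x)) (a ∷ b ∷ c ∷ []))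
      }
    ; ∨-complement = (λ a → law (¬ᵗ x ∨ᵗ x) 𝟏ᵗ (a ∷ [])) , (λ a → law (x ∨ᵗ ¬ᵗ x) 𝟏ᵗ (a ∷ []))
    ; ∧-complement = (λ a → law (¬ᵗ x ∧ᵗ x) 𝟎ᵗ (a ∷ [])) , (λ a → law (x ∧ᵗ ¬ᵗ x) 𝟎ᵗ (a ∷ []))
    ; ¬-cong       = cong ¬_
    }
    where law = booleanIdentity

  bottomFibre-isBochvarSystem : IsBochvarSystem (ΓObj A bottomFibre-closed)
  bottomFibre-isBochvarSystem = record
    { isBooleanAlgebra = bottomFibre-isBooleanAlgebra
    ; I-resp = λ _ _ → subst (K A)
    ; I-𝟏    = 𝟏∈K
    ; I-∧    = λ _ _ → K-∧
    }

module _ (A₁ A₂ : BochvarAlgebra) (f : Hom A₁ A₂) where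
  private
    F = proj₁ f
  open IsHom (proj₂ f)

  hom-preserves-bottomFibre : ∀ a → BotFib A₁ a → BotFib A₂ (F a)
  hom-preserves-bottomFibre a (e₁ , e₂) =
    hom-preserves-≡ (proj₂ f) (x ∧ᵗ (x ∨ᵗ 𝟎ᵗ)) x (a ∷ []) e₁ ,
    hom-preserves-≡ (proj₂ f) (𝟎ᵗ ∧ᵗ (𝟎ᵗ ∨ᵗ x)) 𝟎ᵗ (a ∷ []) e₂

  hom-preserves-K : ∀ {k} → K A₁ k → K A₂ (F k)
  hom-preserves-K (t , t-top , refl) =
    F t ,
    ¬∨-fixed⇒fibreTop A₂ (hom-preserves-≡ (proj₂ f) (¬ᵗ x ∨ᵗ x) x (t ∷ []) (fibreTop⇒¬∨-fixed A₁ t-top)) ,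
    f-J t

  restriction-isSysMorphism : IsSysMorphism (ΓObj A₁ (bottomFibre-closed A₁)) (ΓObj A₂ (bottomFibre-closed A₂))
                                            (ΓMap A₁ A₂ f hom-preserves-bottomFibre)
  restriction-isSysMorphism = record
    { g-cong = λ _ _ → cong F
    ; g-∧    = λ _ _ → f-∧ _ _
    ; g-∨    = λ _ _ → f-∨ _ _
    ; g-¬    = λ _ → f-¬ _
    ; g-0    = f-0
    ; g-1    = f-1
    ; g-I    = λ _ → hom-preserves-K
    }

lemma3p7 : GammaIsFunctor
lemma3p7 = record
  { closed   = bottomFibre-closed
  ; isSystem = bottomFibre-isBochvarSystem
  ; botPres  = hom-preserves-bottomFibre
  ; isMorph  = restriction-isSysMorphism
  ; pres-id  = λ _ _ → refl
  ; pres-∘   = λ _ _ _ _ _ _ → refl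
  }
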